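{- Let $\mathcal{A}$ be a non-empty finite set of agents and $\mathcal{P}$ a non-empty countable set of atoms. Let $\alpha$ be an action formula and let $(M,U)$ be a multi-pointed Kripke model whose underlying model $M$ belongs to $\mathcal{K}45$ (all accessibility relations transitive and Euclidean). Then the Kripke model underlying $(M,U)\otimes\tau(\alpha)$ belongs to $\mathcal{K}45$, where $\tau$ is the $\mathcal{K}45$ translation described in the context.
   Context: A Kripke model $M=(S,R,V)$ has a non-empty set of states $S$, relations $R_a\subseteq S\times S$ for each agent $a$, and a valuation $V:\mathcal{P}\to 2^S$; a multi-pointed Kripke model is $(M,U)$ with $U\subseteq S$. $\mathcal{K}45$ is the class of Kripke models whose relations are all transitive and Euclidean. An action model is $\mathsf{M}=(\mathsf{S},\to,\mathsf{pre})$ with $\mathsf{S}$ a non-empty finite set, relations $\to_a\subseteq\mathsf{S}\times\mathsf{S}$ and preconditions $\mathsf{pre}(e)$ (formulas); multi-pointed: $(\mathsf{M},\mathsf{T})$, $\mathsf{T}\subseteq\mathsf{S}$. Execution: $M\otimes\mathsf{M}$ has states $\{(w,e)\mid M,w\models\mathsf{pre}(e)\}$, $(w,e)R'_a(v,f)$ iff $wR_av$ and $e\to_a f$, and $(w,e)\in V'(p)$ iff $w\in V(p)$; $(M,U)\otimes(\mathsf{M},\mathsf{T})=(M\otimes\mathsf{M},(U\times\mathsf{T})\cap S')$. Formulae and action formulae: $\varphi ::= p \mid \neg\varphi \mid (\varphi\wedge\varphi) \mid \Box_a\varphi \mid [\alpha]\varphi$; $\alpha ::= ?\varphi \mid \alpha\cup\alpha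 \mid \alpha;\alpha \mid L_B(\alpha,\alpha)$ with $\emptyset\ne B\subseteq\mathcal{A}$. Sequential composition $(\mathsf{M},\mathsf{T})\otimes(\mathsf{M}',\mathsf{T}')$: domain $\mathsf{S}\times\mathsf{S}'$, $(e,e')\to_a(f,f')$ iff $e\to_af$ and $e'\to'_af'$, $\mathsf{pre}((e,e'))=\langle\mathsf{M},e\rangle\mathsf{pre}'(e')$, designated $\mathsf{T}\times\mathsf{T}'$. The $\mathcal{K}45$ translation $\tau$: $\tau(?\varphi)$ has points $t,s$, $\to_a=\{(t,s),(s,s)\}$ for all $a$, $\mathsf{pre}(t)=\varphi$, $\mathsf{pre}(s)=\top$, designated $\{t\}$; $\tau(\alpha\cup\beta)$ is the disjoint union of $\tau(\alpha),\tau(\beta)$ (designated sets united); $\tau(\alpha;\beta)=\tau(\alpha)\otimes\tau(\beta)$; for $\tau(\alpha)=((\mathsf{S}^\alpha,\to^\alpha,\mathsf{pre}^\alpha),\mathsf{T}^\alpha)$, $\tau(L_B(\alpha,\alpha))$ has domain $\mathsf{S}^\alpha\cup\{t,s\}\cup\{\hat u\mid u\in\mathsf{T}^\alpha\}$ (all new points), for $a\in B$: $\to_a=\to^\alpha_a\cup\{(s,s)\}\cup\{(t,\hat u)\mid u\in\mathsf{T}^\alpha\}\cup\{(\hat u,\hat v)\mid u,v\in\mathsf{T}^\alpha\}$, for $a\notin B$: $\to_a=\to^\alpha_a\cup\{(t,s),(s,s)\}\cup\{(\hat u,v)\mid u\in\mathsf{T}^\alpha, u\to^\alpha_a v\}$,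 $\mathsf{pre}$ extends $\mathsf{pre}^\alpha$ with $\mathsf{pre}(t)=\mathsf{pre}(s)=\top$, $\mathsf{pre}(\hat u)=\mathsf{pre}^\alpha(u)$, designated $\{t\}$; and $\tau(L_B(\alpha,\beta))=\tau(L_B(\alpha\cup\beta,\alpha\cup\beta))$. -}

module Defs where

open import Data.Nat using (ℕ; suc)
open import Data.Fin using (Fin)
open import Data.Fin.Subset using (Subset; Nonempty)
open import Data.Vec using (lookup)
open import Data.Bool using (Bool; true; false; T; if_then_else_; _∧_)
open import Data.Bool.Properties using (T?; T-irrelevant)
open import Data.Unit using (⊤; tt)
open import Data.Empty using (⊥)
open import Data.Product using (Σ; _×_; _,_; proj₁; proj₂)
open import Data.Sum using (_⊎_; inj₁; inj₂)
open import Data.List using (List; []; _∷_; _++_; map; cartesianProduct)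
open import Data.List.Membership.Propositional using (_∈_)
open import Data.List.Membership.Propositional.Properties
  using (∈-++⁺ˡ; ∈-++⁺ʳ; ∈-map⁺; ∈-cartesianProduct⁺)
open import Data.List.Relation.Unary.Any using (here; there)
open import Relation.Nullary using (yes; no)
open import Relation.Binary.PropositionalEquality using (_≡_; refl; cong)

-- Agents: the non-empty finite set  𝒜 = Fin (suc nA).
-- Atoms: an arbitrary type P (non-emptiness / countability are
-- hypotheses of the theorem).

Agent : ℕ → Set
Agent nA = Fin (suc nA)

record Finite (E : Set) : Set where
  field
    enum     : List E
    complete : ∀ e → e ∈ enum

record Kripke (nA : ℕ) (P : Set) : Set₁ where
  field
    S : Set
    R : Agent nA → S → S → Set
    V : P → S → Set

record PKripke (nA : ℕ) (P : Set) : Set₁ where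
  field
    model : Kripke nA P
    des   : Kripke.S model → Set

Transitive : {S : Set} → (S → S → Set) → Set
Transitive R = ∀ {x y z} → R x y → R y z → R x z

Euclidean : {S : Set} → (S → S → Set) → Set
Euclidean R = ∀ {x y z} → R x y → R x z → R y z

K45 : ∀ {nA P} → Kripke nA P → Set
K45 {nA} M = (a : Agent nA) → Transitive (Kripke.R M a) × Euclidean (Kripke.R M a)

-- The language with action-model modalities (preconditions of action
-- models live here).  ⟨𝖬,e⟩ψ is  ¬[𝖬,e]¬ψ.  ⊤ is a primitive.

module _ {nA : ℕ} {P : Set} where

  mutual
    record AM : Set₁ where
      inductive
      field
        E      : Set
        point  : E
        finite : Finite E
        rel    : Agent nA → E → E → Set
        pre    : E → AMForm

    data AMForm : Set₁ where
      top  : AMForm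
      atom : P → AMForm
      neg  : AMForm → AMForm
      and  : AMForm → AMForm → AMForm
      box  : Agent nA → AMForm → AMForm
      amod : (𝖬 : AM) → AM.E 𝖬 → AMForm → AMForm

  record PAM : Set₁ where
    field
      am  : AM
      des : AM.E am → Bool

  prodWith : (M : Kripke nA P) (E : Set) → (Agent nA → E → E → Set)
           → (Kripke.S M → E → Set) → Kripke nA P
  prodWith M E rel Q = record
    { S = Σ (Kripke.S M × E) (λ we → Q (proj₁ we) (proj₂ we))
    ; R = λ a x y → Kripke.R M a (proj₁ (proj₁ x)) (proj₁ (proj₁ y))
                  × rel a (proj₂ (proj₁ x)) (proj₂ (proj₁ y))
    ; V = λ p x → Kripke.V M p (proj₁ (proj₁ x))
    }

  sat : (M : Kripke nA P) → Kripke.S M → AMForm → Set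
  sat M w top        = ⊤
  sat M w (atom p)   = Kripke.V M p w
  sat M w (neg φ)    = sat M w φ → ⊥
  sat M w (and φ ψ)  = sat M w φ × sat M w ψ
  sat M w (box a φ)  = ∀ v → Kripke.R M a w v → sat M v φ
  sat M w (amod 𝖬 e φ) =
    (pw : sat M w (AM.pre 𝖬 e)) →
    sat (prodWith M (AM.E 𝖬) (AM.rel 𝖬) (λ v f → sat M v (AM.pre 𝖬 f)))
        ((w , e) , pw) φ

  _⊗_ : Kripke nA P → AM → Kripke nA P
  M ⊗ 𝖬 = prodWith M (AM.E 𝖬) (AM.rel 𝖬) (λ v f → sat M v (AM.pre 𝖬 f))

  _⊗ₚ_ : PKripke nA P → PAM → PKripke nA P
  Mu ⊗ₚ 𝖬t = record
    { model = PKripke.model Mu ⊗ PAM.am 𝖬t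
    ; des   = λ x → PKripke.des Mu (proj₁ (proj₁ x))
                  × T (PAM.des 𝖬t (proj₂ (proj₁ x)))
    }

module _ {nA : ℕ} {P : Set} where

  mutual
    data Form : Set where
      patom : P → Form
      pneg  : Form → Form
      pand  : Form → Form → Form
      pbox  : Agent nA → Form → Form
      pact  : AForm → Form → Form

    data AForm : Set where
      test : Form → AForm
      _∪_  : AForm → AForm → AForm
      _⨾_  : AForm → AForm → AForm
      L    : (B : Subset (suc nA)) → Nonempty B → AForm → AForm → AForm

data TS : Set where
  t s : TS

module _ {nA : ℕ} {P : Set} where

  private
    AMF = AMForm {nA} {P}

  finTS : Finite TS
  finTS = record { enum = t ∷ s ∷ [] ; complete = λ { t → here refl ; s → there (here refl) } }

  finSum : ∀ {A B : Set} → Finite A → Finite B → Finite (A ⊎ B)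
  finSum fa fb = record
    { enum = map inj₁ (Finite.enum fa) ++ map inj₂ (Finite.enum fb)
    ; complete = λ { (inj₁ x) → ∈-++⁺ˡ (∈-map⁺ inj₁ (Finite.complete fa x))
                   ; (inj₂ y) → ∈-++⁺ʳ (map inj₁ (Finite.enum fa))
                                        (∈-map⁺ inj₂ (Finite.complete fb y)) } }

  finProd : ∀ {A B : Set} → Finite A → Finite B → Finite (A × B)
  finProd fa fb = record
    { enum = cartesianProduct (Finite.enum fa) (Finite.enum fb)
    ; complete = λ { (x , y) → ∈-cartesianProduct⁺ (Finite.complete fa x) (Finite.complete fb y) } }

  Hat : (E : Set) → (E → Bool) → Set
  Hat E d = Σ E (λ u → T (d u))

  hatList : ∀ {E : Set} (d : E → Bool) → List E → List (Hat E d)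
  hatList d [] = []
  hatList d (x ∷ xs) with T? (d x)
  ... | yes p = (x , p) ∷ hatList d xs
  ... | no _  = hatList d xs

  hatComplete : ∀ {E : Set} (d : E → Bool) (xs : List E) (u : E) (p : T (d u))
              → u ∈ xs → (u , p) ∈ hatList d xs
  hatComplete d (x ∷ xs) u p (here refl) with T? (d u)
  ... | yes q = here (cong (u ,_) (T-irrelevant p q))
  ... | no ¬q with ¬q p
  ...   | ()
  hatComplete d (x ∷ xs) u p (there m) with T? (d x)
  ... | yes _ = there (hatComplete d xs u p m)
  ... | no _  = hatComplete d xs u p m

  finHat : ∀ {E : Set} (d : E → Bool) → Finite E → Finite (Hat E d)
  finHat d fe = record
    { enum = hatList d (Finite.enum fe)
    ; complete = λ { (u , p) → hatComplete d (Finite.enum fe) u p (Finite.complete fe u) } }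

  τtest : AMF → PAM {nA} {P}
  τtest φ = record
    { am = record
      { E = TS ; point = t ; finite = finTS
      ; rel = λ { a _ t → ⊥ ; a _ s → ⊤ }
      ; pre = λ { t → φ ; s → top } }
    ; des = λ { t → true ; s → false } }

  τunion : PAM {nA} {P} → PAM {nA} {P} → PAM {nA} {P}
  τunion 𝔸 𝔹 = record
    { am = record
      { E = AM.E A ⊎ AM.E B
      ; point = inj₁ (AM.point A)
      ; finite = finSum (AM.finite A) (AM.finite B)
      ; rel = λ { a (inj₁ x) (inj₁ y) → AM.rel A a x y
                ; a (inj₂ x) (inj₂ y) → AM.rel B a x y
                ; a (inj₁ _) (inj₂ _) → ⊥
                ; a (inj₂ _) (inj₁ _) → ⊥ }
      ; pre = λ { (inj₁ x) → AM.pre A x ; (inj₂ y) → AM.pre B y } }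
    ; des = λ { (inj₁ x) → PAM.des 𝔸 x ; (inj₂ y) → PAM.des 𝔹 y } }
    where
      A = PAM.am 𝔸
      B = PAM.am 𝔹

  τseq : PAM {nA} {P} → PAM {nA} {P} → PAM {nA} {P}
  τseq 𝔸 𝔹 = record
    { am = record
      { E = AM.E A × AM.E B
      ; point = AM.point A , AM.point B
      ; finite = finProd (AM.finite A) (AM.finite B)
      ; rel = λ { a (e , e') (f , f') → AM.rel A a e f × AM.rel B a e' f' }
      -- pre((e,e')) = ⟨𝖬,e⟩ pre'(e') = ¬[𝖬,e]¬pre'(e')
      ; pre = λ { (e , e') → neg (amod A e (neg (AM.pre B e'))) } }
    ; des = λ { (e , e') → PAM.des 𝔸 e ∧ PAM.des 𝔹 e' } }
    where
      A = PAM.am 𝔸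
      B = PAM.am 𝔹

  module _ (𝔸 : PAM {nA} {P}) where
    private
      A = PAM.am 𝔸
      E = AM.E A
      H = Hat E (PAM.des 𝔸)

    LDom : Set
    LDom = E ⊎ (TS ⊎ H)

    relIn : Agent nA → LDom → LDom → Set
    relIn a (inj₁ x)        (inj₁ y)        = AM.rel A a x y
    relIn a (inj₂ (inj₁ s)) (inj₂ (inj₁ s)) = ⊤
    relIn a (inj₂ (inj₁ t)) (inj₂ (inj₂ _)) = ⊤
    relIn a (inj₂ (inj₂ _)) (inj₂ (inj₂ _)) = ⊤
    relIn a _               _               = ⊥

    relOut : Agent nA → LDom → LDom → Set
    relOut a (inj₁ x)              (inj₁ y)        = AM.rel A a x y
    relOut a (inj₂ (inj₁ t))       (inj₂ (inj₁ s)) = ⊤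
    relOut a (inj₂ (inj₁ s))       (inj₂ (inj₁ s)) = ⊤
    relOut a (inj₂ (inj₂ (u , _))) (inj₁ v)        = AM.rel A a u v
    relOut a _                     _               = ⊥

    preL : LDom → AMForm {nA} {P}
    preL (inj₁ x)              = AM.pre A x
    preL (inj₂ (inj₁ _))       = top
    preL (inj₂ (inj₂ (u , _))) = AM.pre A u

    desL : LDom → Bool
    desL (inj₂ (inj₁ t)) = true
    desL _               = false

    τL : Subset (suc nA) → PAM {nA} {P}
    τL B = record
      { am = record
        { E = LDom
        ; point = inj₂ (inj₁ t)
        ; finite = finSum (AM.finite A) (finSum finTS (finHat (PAM.des 𝔸) (AM.finite A)))
        ; rel = λ a → if lookup B a then relIn a else relOut a
        ; pre = preL }
      ; des = desL }

module _ {nA : ℕ} {P : Set} where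

  bigAnd : ∀ {E : Set} → List E → (E → Bool) → (E → AMForm {nA} {P}) → AMForm {nA} {P}
  bigAnd []       d f = top
  bigAnd (x ∷ xs) d f = if d x then and (f x) (bigAnd xs d f) else bigAnd xs d f

  mutual
    tr : Form {nA} {P} → AMForm {nA} {P}
    tr (patom p)  = atom p
    tr (pneg φ)   = neg (tr φ)
    tr (pand φ ψ) = and (tr φ) (tr ψ)
    tr (pbox a φ) = box a (tr φ)
    tr (pact α φ) = bigAnd (Finite.enum (AM.finite (PAM.am (τ α))))
                           (PAM.des (τ α))
                           (λ e → amod (PAM.am (τ α)) e (tr φ))

    τ : AForm {nA} {P} → PAM {nA} {P}
    τ (test φ)    = τtest (tr φ)
    τ (α ∪ β)     = τunion (τ α) (τ β)
    τ (α ⨾ β)     = τseq (τ α) (τ β)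
    -- τ(L_B(α,β)) = τ(L_B(α∪β, α∪β))
    τ (L B _ α β) = τL (τunion (τ α) (τ β)) B

module Submission where

-- A relation is transitive and Euclidean iff related points have the same
-- successors.  Every clause of τ preserves this for the action model: the
-- new points t, s of a test or of L_B either lead to the sink s, or (for
-- agents in B) into the cluster of hatted copies, which all share the
-- successors of t; a hatted copy û for an agent outside B has exactly the
-- successors of u.  Unions are disjoint sums, and sequential composition
-- and execution in M take pointwise products of the relations, which
-- preserve both properties.

open import Defs
open import Data.Nat using (ℕ; suc)
open import Data.Fin.Subset using (Subset)
open import Data.Bool using (true; false)
open import Data.Product using (_×_; _,_; proj₁)
open import Data.Product.Relation.Binary.Pointwise.NonDependent using (Pointwise; ×-transitive)
open import Data.Sum using (inj₁; inj₂)
open import Data.Vec using (lookup)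
open import Function.Base using (_on_)
open import Function.Bundles using (_⇔_; mk⇔; Equivalence)
open import Function.Construct.Identity using (⇔-id)
open import Function.Definitions using (Injective)
open import Relation.Binary.Construct.On as On using ()
open import Relation.Binary.PropositionalEquality using (_≡_)

K45Relation : {S : Set} → (S → S → Set) → Set
K45Relation R = Transitive R × Euclidean R

SuccessorsAgree : {S : Set} → (S → S → Set) → Set
SuccessorsAgree R = ∀ x y → R x y → ∀ z → R y z ⇔ R x z

module _ {S : Set} {R : S → S → Set} where

  K45⇒successorsAgree : K45Relation R → SuccessorsAgree R
  K45⇒successorsAgree (trans , eucl) _ _ xRy _ = mk⇔ (trans xRy) (eucl xRy)

  successorsAgree⇒K45 : SuccessorsAgree R → K45Relation R
  successorsAgree⇒K45 agree =
    (λ {x} {y} xRy → Equivalence.to (agree x y xRy _)) ,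
    (λ {x} {y} xRy → Equivalence.from (agree x y xRy _))

K45-on : ∀ {A B : Set} {R : B → B → Set} (f : A → B) → K45Relation R → K45Relation (R on f)
K45-on {R = R} f (trans , eucl) = On.transitive f R trans , eucl

K45-× : ∀ {A B : Set} {R : A → A → Set} {S : B → B → Set}
      → K45Relation R → K45Relation S → K45Relation (Pointwise R S)
K45-× {R = R} {S} (trans₁ , eucl₁) (trans₂ , eucl₂) =
  ×-transitive {R = R} {S = S} trans₁ trans₂ , λ (p , q) (p′ , q′) → eucl₁ p p′ , eucl₂ q q′

module _ {nA : ℕ} {P : Set} where

  K45Action : AM {nA} {P} → Set
  K45Action 𝖬 = ∀ a → K45Relation (AM.rel 𝖬 a)

  ⊗-K45 : {M : Kripke nA P} {𝖬 : AM} → K45 M → K45Action 𝖬 → K45 (M ⊗ 𝖬)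
  ⊗-K45 kM k𝖬 a = K45-on proj₁ (K45-× (kM a) (k𝖬 a))

  τtest-K45 : (φ : AMForm) → K45Action (PAM.am (τtest φ))
  τtest-K45 φ a = successorsAgree⇒K45 λ _ _ _ → λ { t → ⇔-id _ ; s → ⇔-id _ }

  τunion-K45 : (𝔸 𝔹 : PAM) → K45Action (PAM.am 𝔸) → K45Action (PAM.am 𝔹)
             → K45Action (PAM.am (τunion 𝔸 𝔹))
  τunion-K45 𝔸 𝔹 k𝔸 k𝔹 a = successorsAgree⇒K45 agree
    where
      agree : SuccessorsAgree (AM.rel (PAM.am (τunion 𝔸 𝔹)) a)
      agree (inj₁ x) (inj₁ y) xRy (inj₁ z) = K45⇒successorsAgree (k𝔸 a) x y xRy z
      agree (inj₁ _) (inj₁ _) _   (inj₂ _) = ⇔-id _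
      agree (inj₂ _) (inj₂ _) _   (inj₁ _) = ⇔-id _
      agree (inj₂ x) (inj₂ y) xRy (inj₂ z) = K45⇒successorsAgree (k𝔹 a) x y xRy z
      agree (inj₁ _) (inj₂ _) ()
      agree (inj₂ _) (inj₁ _) ()

  τseq-K45 : (𝔸 𝔹 : PAM) → K45Action (PAM.am 𝔸) → K45Action (PAM.am 𝔹)
           → K45Action (PAM.am (τseq 𝔸 𝔹))
  τseq-K45 𝔸 𝔹 k𝔸 k𝔹 a = K45-× (k𝔸 a) (k𝔹 a)

module _ {nA : ℕ} {P : Set} (𝔸 : PAM {nA} {P}) (k𝔸 : K45Action (PAM.am 𝔸)) (a : Agent nA) where

  private
    pattern old e = inj₁ e
    pattern new c = inj₂ (inj₁ c)
    pattern hat u = inj₂ (inj₂ u)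

    agreeOld : SuccessorsAgree (AM.rel (PAM.am 𝔸) a)
    agreeOld = K45⇒successorsAgree (k𝔸 a)

  relIn-K45 : K45Relation (relIn 𝔸 a)
  relIn-K45 = successorsAgree⇒K45 agree
    where
      agree : SuccessorsAgree (relIn 𝔸 a)
      agree (old x)   (old y)   xRy (old z)  = agreeOld x y xRy z
      agree (old _)   (old _)   _   (inj₂ _) = ⇔-id _
      agree (new s)   (new s)   _   _        = ⇔-id _
      agree (new t)   (hat _)   _   (old _)  = ⇔-id _
      agree (new t)   (hat _)   _   (new _)  = ⇔-id _
      agree (new t)   (hat _)   _   (hat _)  = ⇔-id _
      agree (hat _)   (hat _)   _   (old _)  = ⇔-id _
      agree (hat _)   (hat _)   _   (new _)  = ⇔-id _
      agree (hat _)   (hat _)   _   (hat _)  = ⇔-id _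
      agree (old _)   (inj₂ _)  ()
      agree (new t)   (old _)   ()
      agree (new s)   (old _)   ()
      agree (hat _)   (old _)   ()
      agree (new t)   (new _)   ()
      agree (new s)   (new t)   ()
      agree (new s)   (hat _)   ()
      agree (hat _)   (new _)   ()

  relOut-K45 : K45Relation (relOut 𝔸 a)
  relOut-K45 = successorsAgree⇒K45 agree
    where
      agree : SuccessorsAgree (relOut 𝔸 a)
      agree (old x)       (old y)  xRy (old z)  = agreeOld x y xRy z
      agree (hat (x , _)) (old y)  xRy (old z)  = agreeOld x y xRy z
      agree (old _)       (old _)  _   (inj₂ _) = ⇔-id _
      agree (hat _)       (old _)  _   (inj₂ _) = ⇔-id _
      agree (new s)       (new s)  _   _        = ⇔-id _
      agree (new t)       (new s)  _   (old _)  = ⇔-id _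
      agree (new t)       (new s)  _   (new t)  = ⇔-id _
      agree (new t)       (new s)  _   (new s)  = ⇔-id _
      agree (new t)       (new s)  _   (hat _)  = ⇔-id _
      agree (old _)       (inj₂ _) ()
      agree (hat _)       (inj₂ _) ()
      agree (new t)       (old _)  ()
      agree (new s)       (old _)  ()
      agree (new t)       (new t)  ()
      agree (new s)       (new t)  ()
      agree (new t)       (hat _)  ()
      agree (new s)       (hat _)  ()

module _ {nA : ℕ} {P : Set} where

  τL-K45 : (𝔸 : PAM {nA} {P}) (B : Subset (suc nA))
         → K45Action (PAM.am 𝔸) → K45Action (PAM.am (τL 𝔸 B))
  τL-K45 𝔸 B k𝔸 a with lookup B a
  ... | true  = relIn-K45 𝔸 k𝔸 a
  ... | false = relOut-K45 𝔸 k𝔸 a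

  τ-K45 : (α : AForm {nA} {P}) → K45Action (PAM.am (τ α))
  τ-K45 (test φ)    = τtest-K45 (tr φ)
  τ-K45 (α ∪ β)     = τunion-K45 (τ α) (τ β) (τ-K45 α) (τ-K45 β)
  τ-K45 (α ⨾ β)     = τseq-K45 (τ α) (τ β) (τ-K45 α) (τ-K45 β)
  τ-K45 (L B _ α β) =
    τL-K45 (τunion (τ α) (τ β)) B (τunion-K45 (τ α) (τ β) (τ-K45 α) (τ-K45 β))

lemma4p11 : (nA : ℕ) (P : Set) (p₀ : P) (code : P → ℕ)
    (code-inj : Injective _≡_ _≡_ code)
    (α : AForm {nA} {P}) (Mu : PKripke nA P)
    (w₀ : Kripke.S (PKripke.model Mu))
    → K45 (PKripke.model Mu)
    → K45 (PKripke.model (Mu ⊗ₚ τ α))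
lemma4p11 _ _ _ _ _ α _ _ kM = ⊗-K45 {𝖬 = PAM.am (τ α)} kM (τ-K45 α)
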